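{- Let $g$ be a counter on a finite graph $G$. If $X,Y\subseteq V(G)$ are disjoint with $g(X,Y)\neq 0$, and $v\in V(G)\setminus(N[X]\cup Y)$, then $v$ has a neighbour in $V(G)\setminus(N[X]\cup Y)$.
   Context: All graphs are finite with no loops or parallel edges. For disjoint $X,Y\subseteq V(G)$, $f_G(X,Y)$ is the sum of $(-1)^{|A|}$ over all stable sets $A$ of $G$ with $X\subseteq A$ and $A\cap Y=\emptyset$. A counter on $G$ is either of the functions $f_G$ or $-f_G$. For $X\subseteq V(G)$, $N[X]$ denotes the set of vertices of $G$ that either belong to $X$ or have a neighbour in $X$. -}

module Defs where

open import Data.Nat using (ℕ; zero; suc)
open import Data.Fin using (Fin)
open import Data.Fin.Subset using (Subset; _∈_; _∉_; _⊆_; inside; outside)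
open import Data.Fin.Subset.Properties using (_∈?_; _⊆?_)
open import Data.Fin.Properties using (all?; any?)
open import Data.Integer using (ℤ; +_; -_; _+_)
open import Data.List using (List; []; _∷_; map; _++_; filter; foldr)
open import Data.Vec using (_∷_)
open import Data.Product using (Σ; ∃; _×_; _,_)
open import Relation.Nullary using (¬_; Dec; yes; no)
open import Relation.Nullary.Decidable using (_×-dec_; _→-dec_; ¬?)
open import Relation.Binary.PropositionalEquality using (_≡_)

record Graph (n : ℕ) : Set₁ where
  field
    Adj   : Fin n → Fin n → Set
    adj?  : ∀ u v → Dec (Adj u v)
    sym   : ∀ {u v} → Adj u v → Adj v u
    irrefl : ∀ {u} → ¬ Adj u u

open Graph public

allSubsets : (n : ℕ) → List (Subset n)
allSubsets zero = Data.Vec.[] ∷ []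
allSubsets (suc n) = map (inside ∷_) (allSubsets n) ++ map (outside ∷_) (allSubsets n)

Disjoint : ∀ {n} → Subset n → Subset n → Set
Disjoint X Y = ∀ v → v ∈ X → v ∉ Y

Stable : ∀ {n} (G : Graph n) → Subset n → Set
Stable G A = ∀ u v → u ∈ A → v ∈ A → ¬ Adj G u v

stable? : ∀ {n} (G : Graph n) (A : Subset n) → Dec (Stable G A)
stable? G A = all? λ u → all? λ v → (u ∈? A) →-dec ((v ∈? A) →-dec ¬? (adj? G u v))

Avoids : ∀ {n} → Subset n → Subset n → Set
Avoids A Y = ∀ v → v ∈ A → v ∉ Y

avoids? : ∀ {n} (A Y : Subset n) → Dec (Avoids A Y)
avoids? A Y = all? λ v → (v ∈? A) →-dec ¬? (v ∈? Y)

Counted : ∀ {n} (G : Graph n) (X Y : Subset n) → Subset n → Set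
Counted G X Y A = Stable G A × X ⊆ A × Avoids A Y

counted? : ∀ {n} (G : Graph n) (X Y : Subset n) (A : Subset n) → Dec (Counted G X Y A)
counted? G X Y A = stable? G A ×-dec ((X ⊆? A) ×-dec avoids? A Y)

sign : ∀ {n} → Subset n → ℤ
sign Data.Vec.[] = + 1
sign (inside ∷ A) = - sign A
sign (outside ∷ A) = sign A

f : ∀ {n} (G : Graph n) (X Y : Subset n) → ℤ
f G X Y = foldr (λ A s → sign A + s) (+ 0) (filter (counted? G X Y) (allSubsets _))

IsCounter : ∀ {n} (G : Graph n) → (Subset n → Subset n → ℤ) → Set
IsCounter G g = (∀ X Y → g X Y ≡ f G X Y) Data.Sum.⊎ (∀ X Y → g X Y ≡ - f G X Y)
  where import Data.Sum

InClosedNbhd : ∀ {n} (G : Graph n) → Subset n → Fin n → Set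
InClosedNbhd G X v = v ∈ X Data.Sum.⊎ ∃ λ u → u ∈ X × Adj G v u
  where import Data.Sum

Outside : ∀ {n} (G : Graph n) → Subset n → Subset n → Fin n → Set
Outside G X Y v = ¬ InClosedNbhd G X v × v ∉ Y

-- Proof idea (a sign-reversing involution).  Let v lie outside N[X] ∪ Y
-- and suppose every neighbour of v lies in N[X] ∪ Y.  For a stable set A
-- counted by f_G(X,Y), no neighbour w of v can belong to A: w ∈ Y is
-- excluded by A ∩ Y = ∅, w ∈ X would put v in N[X], and a neighbour of w
-- in X ⊆ A would contradict stability.  Hence toggling the membership of
-- v maps counted sets to counted sets; it is an involution changing |A|
-- by one, so the signed sum f_G(X,Y) is 0, and so is every counter.
module Submission where

open import Defs hiding (sym)
open import Level using (0ℓ)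
open import Data.Nat using (ℕ; zero; suc)
open import Data.Fin using (Fin; zero; suc)
open import Data.Fin.Properties using (any?) renaming (_≟_ to _≟ᶠ_)
open import Data.Fin.Subset using (Subset; inside; outside; _∈_; _∉_)
open import Data.Fin.Subset.Properties using (_∈?_)
open import Data.Integer using (ℤ; +_; -_; _+_)
open import Data.Integer.Properties using (+-inverseˡ; +-identityˡ; +-assoc; neg-distrib-+)
open import Data.Bool using (true; false; not)
open import Data.List using (List; []; _∷_; map; _++_; filter; foldr)
open import Data.List.Properties using (filter-++; filter-≐)
open import Data.Vec using (_∷_; here; there)
open import Data.Product using (∃; _×_; _,_)
open import Data.Sum using (inj₁; inj₂; [_,_])
open import Data.Empty using (⊥-elim)
open import Relation.Nullary using (¬_; Dec; yes; no; does)
open import Relation.Nullary.Decidable using (_×-dec_; _⊎-dec_; ¬?)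
open import Relation.Unary using (Pred; Decidable)
open import Relation.Binary.PropositionalEquality
  using (_≡_; _≢_; refl; sym; trans; cong; cong₂; subst; module ≡-Reasoning)

open ≡-Reasoning

signSum : ∀ {n} → List (Subset n) → ℤ
signSum = foldr (λ A s → sign A + s) (+ 0)

signSum-++ : ∀ {n} (xs ys : List (Subset n)) →
  signSum (xs ++ ys) ≡ signSum xs + signSum ys
signSum-++ []       ys = sym (+-identityˡ (signSum ys))
signSum-++ (x ∷ xs) ys = begin
  sign x + signSum (xs ++ ys)           ≡⟨ cong (λ s → sign x + s) (signSum-++ xs ys) ⟩
  sign x + (signSum xs + signSum ys)    ≡⟨ sym (+-assoc (sign x) _ _) ⟩
  sign x + signSum xs + signSum ys      ∎

signSum-inside : ∀ {n} (xs : List (Subset n)) →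
  signSum (map (inside ∷_) xs) ≡ - signSum xs
signSum-inside []       = refl
signSum-inside (x ∷ xs) = begin
  - sign x + signSum (map (inside ∷_) xs)  ≡⟨ cong (λ s → - sign x + s) (signSum-inside xs) ⟩
  - sign x + - signSum xs                  ≡⟨ sym (neg-distrib-+ (sign x) _) ⟩
  - (sign x + signSum xs)                  ∎

signSum-outside : ∀ {n} (xs : List (Subset n)) →
  signSum (map (outside ∷_) xs) ≡ signSum xs
signSum-outside []       = refl
signSum-outside (x ∷ xs) = cong (λ s → sign x + s) (signSum-outside xs)

filter-map : ∀ {A B : Set} {P : Pred B 0ℓ} (P? : Decidable P) (g : A → B) (xs : List A) →
  filter P? (map g xs) ≡ map g (filter (λ x → P? (g x)) xs)
filter-map P? g []       = refl
filter-map P? g (x ∷ xs) with does (P? (g x))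
... | true  = cong (g x ∷_) (filter-map P? g xs)
... | false = filter-map P? g xs

signSum-split : ∀ {n} {P : Pred (Subset (suc n)) 0ℓ} (P? : Decidable P) →
  signSum (filter P? (allSubsets (suc n)))
    ≡ - signSum (filter (λ B → P? (inside ∷ B)) (allSubsets n))
      + signSum (filter (λ B → P? (outside ∷ B)) (allSubsets n))
signSum-split {n} P? = begin
  signSum (filter P? (map (inside ∷_) S ++ map (outside ∷_) S))
    ≡⟨ cong signSum (filter-++ P? (map (inside ∷_) S) _) ⟩
  signSum (filter P? (map (inside ∷_) S) ++ filter P? (map (outside ∷_) S))
    ≡⟨ signSum-++ (filter P? (map (inside ∷_) S)) _ ⟩
  signSum (filter P? (map (inside ∷_) S)) + signSum (filter P? (map (outside ∷_) S))
    ≡⟨ cong₂ (λ a b → signSum a + signSum b) (filter-map P? (inside ∷_) S)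
                                             (filter-map P? (outside ∷_) S) ⟩
  signSum (map (inside ∷_) Sᵢ) + signSum (map (outside ∷_) Sₒ)
    ≡⟨ cong₂ _+_ (signSum-inside Sᵢ) (signSum-outside Sₒ) ⟩
  - signSum Sᵢ + signSum Sₒ ∎
  where
  S Sᵢ Sₒ : List (Subset n)
  S  = allSubsets n
  Sᵢ = filter (λ B → P? (inside ∷ B)) S
  Sₒ = filter (λ B → P? (outside ∷ B)) S

toggle : ∀ {n} → Fin n → Subset n → Subset n
toggle zero    (b ∷ A) = not b ∷ A
toggle (suc w) (b ∷ A) = b ∷ toggle w A

toggle-involutive : ∀ {n} (v : Fin n) (A : Subset n) → toggle v (toggle v A) ≡ A
toggle-involutive zero    (true  ∷ A) = refl
toggle-involutive zero    (false ∷ A) = refl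
toggle-involutive (suc w) (b ∷ A)     = cong (b ∷_) (toggle-involutive w A)

∈-toggle⁺ : ∀ {n} (v u : Fin n) (A : Subset n) → u ≢ v → u ∈ A → u ∈ toggle v A
∈-toggle⁺ zero    zero    A       u≢v _         = ⊥-elim (u≢v refl)
∈-toggle⁺ (suc v) zero    (b ∷ A) u≢v here      = here
∈-toggle⁺ zero    (suc u) (b ∷ A) u≢v (there p) = there p
∈-toggle⁺ (suc v) (suc u) (b ∷ A) u≢v (there p) =
  there (∈-toggle⁺ v u A (λ u≡v → u≢v (cong suc u≡v)) p)

∈-toggle⁻ : ∀ {n} (v u : Fin n) (A : Subset n) → u ≢ v → u ∈ toggle v A → u ∈ A
∈-toggle⁻ v u A u≢v p =
  subst (u ∈_) (toggle-involutive v A) (∈-toggle⁺ v u (toggle v A) u≢v p)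

-- When v
-- is the first vertex the two halves of signSum-split coincide and
-- cancel; otherwise both halves vanish by induction.
signSum-toggle-closed : ∀ {n} (v : Fin n) {P : Pred (Subset n) 0ℓ} (P? : Decidable P) →
  (∀ A → P A → P (toggle v A)) → signSum (filter P? (allSubsets n)) ≡ + 0
signSum-toggle-closed {suc n} zero P? closed = begin
  signSum (filter P? (allSubsets (suc n)))   ≡⟨ signSum-split P? ⟩
  - signSum Sᵢ + signSum Sₒ                  ≡⟨ cong (λ s → - s + signSum Sₒ) Sᵢ≡Sₒ ⟩
  - signSum Sₒ + signSum Sₒ                  ≡⟨ +-inverseˡ (signSum Sₒ) ⟩
  + 0                                        ∎
  where
  Sᵢ Sₒ : List (Subset n)
  Sᵢ = filter (λ B → P? (inside ∷ B)) (allSubsets n)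
  Sₒ = filter (λ B → P? (outside ∷ B)) (allSubsets n)
  Sᵢ≡Sₒ : signSum Sᵢ ≡ signSum Sₒ
  Sᵢ≡Sₒ = cong signSum (filter-≐ (λ B → P? (inside ∷ B)) (λ B → P? (outside ∷ B))
            ((λ {B} → closed (inside ∷ B)) , (λ {B} → closed (outside ∷ B)))
            (allSubsets n))
signSum-toggle-closed {suc n} (suc w) P? closed = begin
  signSum (filter P? (allSubsets (suc n)))   ≡⟨ signSum-split P? ⟩
  - signSum Sᵢ + signSum Sₒ                  ≡⟨ cong₂ (λ a b → - a + b) Sᵢ≡0 Sₒ≡0 ⟩
  + 0                                        ∎
  where
  Sᵢ Sₒ : List (Subset n)
  Sᵢ = filter (λ B → P? (inside ∷ B)) (allSubsets n)
  Sₒ = filter (λ B → P? (outside ∷ B)) (allSubsets n)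
  Sᵢ≡0 : signSum Sᵢ ≡ + 0
  Sᵢ≡0 = signSum-toggle-closed w (λ B → P? (inside ∷ B)) (λ B → closed (inside ∷ B))
  Sₒ≡0 : signSum Sₒ ≡ + 0
  Sₒ≡0 = signSum-toggle-closed w (λ B → P? (outside ∷ B)) (λ B → closed (outside ∷ B))

inClosedNbhd? : ∀ {n} (G : Graph n) (X : Subset n) (u : Fin n) → Dec (InClosedNbhd G X u)
inClosedNbhd? G X u = (u ∈? X) ⊎-dec any? (λ x → (x ∈? X) ×-dec adj? G u x)

outside? : ∀ {n} (G : Graph n) (X Y : Subset n) (u : Fin n) → Dec (Outside G X Y u)
outside? G X Y u = ¬? (inClosedNbhd? G X u) ×-dec ¬? (u ∈? Y)

module IsolatedOutside {n} (G : Graph n) (X Y : Subset n) (v : Fin n)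
  (v∉N[X] : ¬ InClosedNbhd G X v) (v∉Y : v ∉ Y)
  (no-outside-nbr : ∀ w → Adj G v w → ¬ Outside G X Y w) where

  -- A counted set contains no neighbour w of v: w ∉ Y since A avoids Y,
  -- and w ∉ N[X] since w ∈ X puts v in N[X] while an edge from w into
  -- X ⊆ A breaks stability; so w would lie outside N[X] ∪ Y.
  no-nbr-in-counted : ∀ A → Counted G X Y A → ∀ w → Adj G v w → w ∉ A
  no-nbr-in-counted A (stable , X⊆A , avoids) w v~w w∈A =
    no-outside-nbr w v~w (w∉N[X] , avoids w w∈A)
    where
    w∉N[X] : ¬ InClosedNbhd G X w
    w∉N[X] (inj₁ w∈X)            = v∉N[X] (inj₂ (w , w∈X , v~w))
    w∉N[X] (inj₂ (x , x∈X , w~x)) = stable w x w∈A (X⊆A x∈X) w~x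

  counted-toggle : ∀ A → Counted G X Y A → Counted G X Y (toggle v A)
  counted-toggle A c@(stable , X⊆A , avoids) = stable′ , X⊆A′ , avoids′
    where
    stable′ : Stable G (toggle v A)
    stable′ u w u∈ w∈ u~w with u ≟ᶠ v | w ≟ᶠ v
    ... | yes refl | yes refl = irrefl G u~w
    ... | yes refl | no w≢v   = no-nbr-in-counted A c w u~w (∈-toggle⁻ v w A w≢v w∈)
    ... | no u≢v   | yes refl = no-nbr-in-counted A c u (Graph.sym G u~w) (∈-toggle⁻ v u A u≢v u∈)
    ... | no u≢v   | no w≢v   = stable u w (∈-toggle⁻ v u A u≢v u∈) (∈-toggle⁻ v w A w≢v w∈) u~w
    X⊆A′ : ∀ {x} → x ∈ X → x ∈ toggle v A
    X⊆A′ {x} x∈X with x ≟ᶠ v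
    ... | yes refl = ⊥-elim (v∉N[X] (inj₁ x∈X))
    ... | no x≢v   = ∈-toggle⁺ v x A x≢v (X⊆A x∈X)
    avoids′ : Avoids (toggle v A) Y
    avoids′ u u∈ with u ≟ᶠ v
    ... | yes refl = v∉Y
    ... | no u≢v   = avoids u (∈-toggle⁻ v u A u≢v u∈)

  f-vanishes : f G X Y ≡ + 0
  f-vanishes = signSum-toggle-closed v (counted? G X Y) counted-toggle

counter-vanishes : ∀ {n} (G : Graph n) (g : Subset n → Subset n → ℤ) → IsCounter G g →
  ∀ X Y → f G X Y ≡ + 0 → g X Y ≡ + 0
counter-vanishes G g counter X Y f≡0 =
  [ (λ g≡f → trans (g≡f X Y) f≡0) , (λ g≡-f → trans (g≡-f X Y) (cong -_ f≡0)) ] counter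

mainTheorem7 : ∀ {n} (G : Graph n) (g : Subset n → Subset n → ℤ) → IsCounter G g →
    (X Y : Subset n) → Disjoint X Y → g X Y ≢ + 0 →
    (v : Fin n) → Outside G X Y v →
    ∃ λ u → Adj G v u × Outside G X Y u
mainTheorem7 G g counter X Y _ g≢0 v (v∉N[X] , v∉Y)
  with any? (λ u → adj? G v u ×-dec outside? G X Y u)
... | yes nbr-outside = nbr-outside
... | no  none        = ⊥-elim (g≢0 (counter-vanishes G g counter X Y f-vanishes))
  where
  open IsolatedOutside G X Y v v∉N[X] v∉Y (λ w v~w w-out → none (w , v~w , w-out))
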